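{- Let $\Sigma$ be a totally ordered alphabet with $\sigma$ letters, let $k\geq 1$ be an integer, and let $w\in\Sigma^\ast$ with $|w|\geq k+1$. Then $$\min_{W\in\mathcal{D}_k(w)}\rho(W)\leq \sigma^{k+1}+4k+2.$$
   Context: For a string $x=x_1\cdots x_n$, $\texttt{runs}(x)=\sum_{i=1}^{n-1}\mathbf{1}_{x_i\neq x_{i+1}}$. Every string $u$ can be written uniquely as $u=v^e$ with $v$ primitive (not a power $z^j$, $j\geq 2$); write $\mathrm{root}(u)=v$, $\exp(u)=e$. The $\omega$-order: $u\preceq_\omega v$ iff either $\mathrm{root}(u)=\mathrm{root}(v)$ and $\exp(u)\leq\exp(v)$, or $\mathrm{root}(u)\neq\mathrm{root}(v)$ and $u^\omega<_{\mathrm{lex}}v^\omega$ (infinite repetitions compared lexicographically). For a multiset $W=\{\!\{w_1,\dots,w_m\}\!\}$ of nonempty strings, the extended Burrows–Wheeler transform $\texttt{ebwt}(W)$ is obtained by listing, for each $i$ and each of the $|w_i|$ positions of $w_i$, the corresponding circular rotation of $w_i$ (so $|w_1|+\cdots+|w_m|$ rotations in total, with multiplicity), sorting them in ascending $\omega$-order, and concatenating their last characters. $\rho(W)=\texttt{runs}(\texttt{ebwt}(W))$. A $k$-restricted decomposition of $w$ is a factorization $w=w_1\cdots w_m$ with $|w_i|>k$ for all $i$, identified with the multiset $\{\!\{w_1,\dots,w_m\}\!\}$ when applying $\rho$; $\mathcal{D}_k(w)$ is the set of all of them. -}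

module Defs where

open import Data.Nat using (ℕ; zero; suc; _+_; _*_; _≤_; _<_; _^_)
open import Data.Nat.DivMod using (_%_)
open import Data.Fin using (Fin) renaming (_<_ to _<ᶠ_)
import Data.Fin as Fin
open import Data.List using (List; []; _∷_; _++_; length; take; drop; map; concat; concatMap; upTo; last)
open import Data.List.Relation.Unary.All using (All)
open import Data.List.Relation.Unary.Linked using (Linked)
open import Data.List.Relation.Binary.Permutation.Propositional using (_↭_)
open import Data.List.Relation.Binary.Pointwise using (Pointwise)
open import Data.Maybe using (Maybe; just; nothing)
open import Data.Product using (Σ; ∃; ∃-syntax; _×_)
open import Data.Sum using (_⊎_)
open import Relation.Binary.PropositionalEquality using (_≡_)
open import Relation.Nullary using (¬_; yes; no)
open import Relation.Nullary.Decidable using (⌊_⌋)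
open import Data.Bool using (if_then_else_)

Str : ℕ → Set
Str σ = List (Fin σ)

runs : ∀ {σ} → Str σ → ℕ
runs [] = 0
runs (x ∷ xs) = go x xs
  where
  go : _ → Str _ → ℕ
  go x [] = 0
  go x (y ∷ ys) = (if ⌊ x Fin.≟ y ⌋ then 0 else 1) + go y ys

pow : ∀ {σ} → Str σ → ℕ → Str σ
pow z zero = []
pow z (suc j) = z ++ pow z j

Primitive : ∀ {σ} → Str σ → Set
Primitive {σ} v = 0 < length v × ¬ (∃[ z ] ∃[ j ] (2 ≤ j × v ≡ pow z j))

HasRoot : ∀ {σ} → Str σ → Str σ → ℕ → Set
HasRoot u v e = Primitive v × u ≡ pow v e

at : ∀ {σ} → Str σ → ℕ → Maybe (Fin σ)
at [] _ = nothing
at (x ∷ xs) zero = just x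
at (x ∷ xs) (suc i) = at xs i

-- u^ω as an infinite sequence (position i ↦ u[i mod |u|]); only used for nonempty u
omega : ∀ {σ} → Str σ → ℕ → Maybe (Fin σ)
omega [] _ = nothing
omega u@(x ∷ xs) i = at u (i % length u)

LexLt : ∀ {σ} → (ℕ → Maybe (Fin σ)) → (ℕ → Maybe (Fin σ)) → Set
LexLt {σ} a b = ∃[ n ] ((∀ i → i < n → a i ≡ b i) ×
                 (∃[ x ] ∃[ y ] (a n ≡ just x × b n ≡ just y × x <ᶠ y)))

_⪯ω_ : ∀ {σ} → Str σ → Str σ → Set
_⪯ω_ {σ} u v =
  (∃[ r ] ∃[ e ] ∃[ f ] (HasRoot u r e × HasRoot v r f × e ≤ f))
  ⊎ (∃[ r ] ∃[ r' ] ∃[ e ] ∃[ f ] (HasRoot u r e × HasRoot v r' f × ¬ (r ≡ r') × LexLt (omega u) (omega v)))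

rot : ∀ {σ} → ℕ → Str σ → Str σ
rot i w = drop i w ++ take i w

rotationsOf : ∀ {σ} → Str σ → List (Str σ)
rotationsOf w = map (λ i → rot i w) (upTo (length w))

rotations : ∀ {σ} → List (Str σ) → List (Str σ)
rotations W = concatMap rotationsOf W

IsEbwt : ∀ {σ} → List (Str σ) → Str σ → Set
IsEbwt {σ} W b = ∃[ L ] (L ↭ rotations W × Linked _⪯ω_ L ×
                          Pointwise (λ r c → last r ≡ just c) L b)

IsKDecomp : ∀ {σ} → ℕ → Str σ → List (Str σ) → Set
IsKDecomp k w D = concat D ≡ w × All (λ x → k < length x) D

{-# OPTIONS --safe #-}
-- Cut w into blocks of length k + 1 followed by a tail t with k < |t| ≤ 2k + 1.  The ω-order is
-- a total order on nonempty strings (roots exist, and are unique because the two periods of a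
-- common ω-sequence yield, by Bézout, a period dividing both primitive root lengths), so in the
-- sorted rotations of the blocks equal strings are adjacent.  These rotations all have length
-- k + 1, hence their last letters have at most σ^(k+1) runs.  Inserting the |t| rotations of the
-- tail one at a time adds at most 2 runs each, which gives σ^(k+1) + 2(2k + 1).
module Submission where

open import Defs
open import Data.Nat
  using (ℕ; zero; suc; _+_; _*_; _^_; _∸_; _≤_; _<_; z≤n; s≤s; NonZero; >-nonZero; _≤?_; _<?_; _/_; _%_)
open import Data.Nat.Properties
open import Data.Nat.DivMod using (m<n⇒m%n≡m; m%n<n; [m+n]%n≡m%n; m≡m%n+[m/n]*n; m∣n⇒o%n%m≡o%m)
open import Data.Nat.Divisibility using (_∣_; divides; ∣⇒≤)
open import Data.Nat.GCD using (gcd; gcd-GCD; gcd[m,n]∣m; gcd[m,n]∣n; gcd[m,n]≢0; module Bézout)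
open import Data.Nat.Induction using (<-wellFounded)
open import Data.Nat.Tactic.RingSolver using (solve-∀)
open import Algebra.Properties.CommutativeSemigroup +-commutativeSemigroup using (x∙yz≈y∙xz)
open import Data.Fin using (Fin) renaming (_<_ to _<ᶠ_)
import Data.Fin.Properties as Fin
open import Data.Maybe using (Maybe; just; nothing)
import Data.Maybe.Properties as Maybe
open import Data.List
  using (List; []; _∷_; [_]; _++_; length; take; drop; map; concat; derun; cartesianProductWith; allFin; upTo; last)
open import Data.List.Properties
  using ( length-++; length-++-sucʳ; length-map; length-tabulate; length-take; length-drop; length-upTo
        ; ++-assoc; ++-identityʳ; map-++; concat-++; take++drop≡id; ≡-dec)
open import Data.List.Membership.Propositional using (_∈_)
open import Data.List.Membership.Propositional.Properties
  using (∈-∃++; ∈-++⁻; ∈-++⁺ˡ; ∈-++⁺ʳ; ∈-cartesianProductWith⁺; ∈-allFin; ∈-derun⁻)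
open import Data.List.Relation.Binary.Pointwise using (Pointwise; []; _∷_; Pointwise-≡⇒≡)
open import Data.List.Relation.Binary.Permutation.Propositional using (_↭_; ↭-trans; ↭-sym; ↭⇒↭ₛ)
open import Data.List.Relation.Binary.Permutation.Propositional.Properties using (++-comm; ∈-resp-↭; All-resp-↭)
open import Data.List.Relation.Binary.Subset.Propositional using (_⊆_)
open import Data.List.Relation.Unary.All using (All; []; _∷_)
import Data.List.Relation.Unary.All as All
import Data.List.Relation.Unary.All.Properties as All
open import Data.List.Relation.Unary.AllPairs using (AllPairs; []; _∷_)
open import Data.List.Relation.Unary.Any using (here; there)
open import Data.List.Relation.Unary.Grouped using (Grouped; []; _∷≉_; _∷≈_)
open import Data.List.Relation.Unary.Grouped.Properties using (grouped[xs]⇒unique[derun[xs]])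
open import Data.List.Relation.Unary.Linked using (Linked; []; [-]; _∷_)
open import Data.List.Relation.Unary.Linked.Properties using (Linked⇒AllPairs)
open import Data.List.Relation.Unary.Sorted.TotalOrder.Properties using (↗↭↗⇒≋)
open import Data.List.Relation.Unary.Unique.Propositional using (Unique)
open import Data.Product using (∃₂; ∃-syntax; _×_; _,_; proj₁; proj₂)
open import Data.Sum using (_⊎_; inj₁; inj₂; [_,_]′)
import Data.Sum as Sum
open import Function using (_∘_; id; const)
open import Induction.WellFounded using (Acc; acc)
open import Level using (0ℓ)
open import Relation.Binary.Bundles using (DecTotalOrder)
open import Relation.Binary.Core using (Rel)
open import Relation.Binary.Definitions using (Antisymmetric; DecidableEquality; tri<; tri≈; tri>)
open import Relation.Binary.PropositionalEquality
  using (_≡_; _≢_; _≗_; refl; sym; trans; cong; cong₂; subst; isEquivalence; module ≡-Reasoning)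
open import Relation.Nullary using (¬_; Dec; yes; no; contradiction)
open import Relation.Nullary.Decidable using (map′; _×-dec_)

private variable
  σ : ℕ

NonEmpty : Str σ → Set
NonEmpty u = 0 < length u

_≟ₛ_ : (u v : Str σ) → Dec (u ≡ v)
_≟ₛ_ = ≡-dec Fin._≟_

-- Powers and positions

length-pow : ∀ (z : Str σ) j → length (pow z j) ≡ j * length z
length-pow z zero    = refl
length-pow z (suc j) = trans (length-++ z) (cong (length z +_) (length-pow z j))

pow-+ : ∀ (z : Str σ) i j → pow z (i + j) ≡ pow z i ++ pow z j
pow-+ z zero    j = refl
pow-+ z (suc i) j = trans (cong (z ++_) (pow-+ z i j)) (sym (++-assoc z (pow z i) (pow z j)))

pow-pow : ∀ (z : Str σ) i j → pow (pow z i) j ≡ pow z (j * i)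
pow-pow z i zero    = refl
pow-pow z i (suc j) = trans (cong (pow z i ++_) (pow-pow z i j)) (sym (pow-+ z i (j * i)))

nonEmpty-pow⁻ : ∀ (z : Str σ) j → NonEmpty (pow z j) → NonEmpty z
nonEmpty-pow⁻ []      j ne = contradiction (trans (length-pow [] j) (*-zeroʳ j)) (>⇒≢ ne)
nonEmpty-pow⁻ (_ ∷ _) j ne = s≤s z≤n

length-<-pow : ∀ (z : Str σ) {j} → NonEmpty z → 2 ≤ j → length z < length (pow z j)
length-<-pow z {j} ne 2≤j = subst (length z <_) (sym (trans (length-pow z j) (*-comm j (length z))))
  (m<m*n (length z) j {{>-nonZero ne}} 2≤j)

exponent-≤-length-pow : ∀ (z : Str σ) j → NonEmpty z → j ≤ length (pow z j)
exponent-≤-length-pow z j ne = subst (j ≤_) (sym (length-pow z j)) (m≤m*n j (length z) {{>-nonZero ne}})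

take-length-++ : ∀ (u v : Str σ) → take (length u) (u ++ v) ≡ u
take-length-++ []      v = refl
take-length-++ (x ∷ u) v = cong (x ∷_) (take-length-++ u v)

at-++ˡ : ∀ (u v : Str σ) {i} → i < length u → at (u ++ v) i ≡ at u i
at-++ˡ (x ∷ u) v {zero}  _         = refl
at-++ˡ (x ∷ u) v {suc i} (s≤s i<n) = at-++ˡ u v i<n

at-++ʳ : ∀ (u v : Str σ) i → at (u ++ v) (length u + i) ≡ at v i
at-++ʳ []      v i = refl
at-++ʳ (x ∷ u) v i = at-++ʳ u v i

at-≥ : ∀ (u : Str σ) {i} → length u ≤ i → at u i ≡ nothing
at-≥ []      _         = refl
at-≥ (x ∷ u) {suc i} (s≤s n≤i) = at-≥ u n≤i

at-< : ∀ (u : Str σ) {i} → i < length u → ∃[ x ] at u i ≡ just x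
at-< (x ∷ u) {zero}  _         = x , refl
at-< (x ∷ u) {suc i} (s≤s i<n) = at-< u i<n

at-take : ∀ (u : Str σ) {d i} → i < d → at (take d u) i ≡ at u i
at-take []      {suc d}         _         = refl
at-take (x ∷ u) {suc d} {zero}  _         = refl
at-take (x ∷ u) {suc d} {suc i} (s≤s i<d) = at-take u i<d

at-ext : ∀ (u v : Str σ) → at u ≗ at v → u ≡ v
at-ext []      []      _  = refl
at-ext []      (y ∷ v) eq with () ← eq 0
at-ext (x ∷ u) []      eq with () ← eq 0
at-ext (x ∷ u) (y ∷ v) eq = cong₂ _∷_ (Maybe.just-injective (eq 0)) (at-ext u v (eq ∘ suc))

at-pow : ∀ (z : Str σ) .{{_ : NonZero (length z)}} j {i} → i < j * length z →
         at (pow z j) i ≡ at z (i % length z)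
at-pow z (suc j) {i} i<[1+j]n with i <? length z
... | yes i<n = trans (at-++ˡ z (pow z j) i<n) (cong (at z) (sym (m<n⇒m%n≡m i<n)))
... | no  i≮n = begin
  at (z ++ pow z j) i       ≡⟨ cong (at (z ++ pow z j)) (sym n+i′≡i) ⟩
  at (z ++ pow z j) (n + i′) ≡⟨ at-++ʳ z (pow z j) i′ ⟩
  at (pow z j) i′           ≡⟨ at-pow z j i′<jn ⟩
  at z (i′ % n)             ≡⟨ cong (at z) (sym ([m+n]%n≡m%n i′ n)) ⟩
  at z ((i′ + n) % n)       ≡⟨ cong (λ m → at z (m % n)) (trans (+-comm i′ n) n+i′≡i) ⟩
  at z (i % n)              ∎
  where
  open ≡-Reasoning
  n = length z
  i′ = i ∸ n
  n+i′≡i : n + i′ ≡ i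
  n+i′≡i = m+[n∸m]≡n (≮⇒≥ i≮n)
  i′<jn : i′ < j * n
  i′<jn = +-cancelˡ-< n i′ (j * n) (subst (_< n + j * n) (sym n+i′≡i) i<[1+j]n)

-- Periods and primitive roots

Seq : ℕ → Set
Seq σ = ℕ → Maybe (Fin σ)

HasPeriod : Seq σ → ℕ → Set
HasPeriod s p = ∀ i → s (i + p) ≡ s i

HasPeriod-resp-≗ : ∀ {s t : Seq σ} {p} → s ≗ t → HasPeriod s p → HasPeriod t p
HasPeriod-resp-≗ s≗t per i = trans (sym (s≗t _)) (trans (per i) (s≗t i))

HasPeriod-* : ∀ {s : Seq σ} {p} → HasPeriod s p → ∀ q i → s (i + q * p) ≡ s i
HasPeriod-* {s = s} per zero    i = cong s (+-identityʳ i)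
HasPeriod-* {s = s} {p} per (suc q) i = begin
  s (i + (p + q * p)) ≡⟨ cong s (trans (cong (i +_) (+-comm p (q * p))) (sym (+-assoc i (q * p) p))) ⟩
  s (i + q * p + p)   ≡⟨ per (i + q * p) ⟩
  s (i + q * p)       ≡⟨ HasPeriod-* per q i ⟩
  s i                 ∎
  where open ≡-Reasoning

-- By Bézout gcd p q + y q = x p (or symmetrically), so a step by gcd p q is undone by steps of p and q.
HasPeriod-gcd : ∀ {s : Seq σ} {p q} → HasPeriod s p → HasPeriod s q → HasPeriod s (gcd p q)
HasPeriod-gcd {s = s} {p} {q} per-p per-q i with Bézout.identity (gcd-GCD p q)
... | Bézout.+- x y d+yq≡xp = begin
  s (i + d)          ≡⟨ HasPeriod-* per-q y (i + d) ⟨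
  s (i + d + y * q)  ≡⟨ cong s (trans (+-assoc i d (y * q)) (cong (i +_) d+yq≡xp)) ⟩
  s (i + x * p)      ≡⟨ HasPeriod-* per-p x i ⟩
  s i                ∎
  where open ≡-Reasoning; d = gcd p q
... | Bézout.-+ x y d+xp≡yq = begin
  s (i + d)          ≡⟨ HasPeriod-* per-p x (i + d) ⟨
  s (i + d + x * p)  ≡⟨ cong s (trans (+-assoc i d (x * p)) (cong (i +_) d+xp≡yq)) ⟩
  s (i + y * q)      ≡⟨ HasPeriod-* per-q y i ⟩
  s i                ∎
  where open ≡-Reasoning; d = gcd p q

omega-period : ∀ (u : Str σ) → NonEmpty u → HasPeriod (omega u) (length u)
omega-period u@(_ ∷ _) _ i = cong (at u) ([m+n]%n≡m%n i (length u))

omega-< : ∀ (u : Str σ) {i} → i < length u → omega u i ≡ at u i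
omega-< u@(_ ∷ _) i<n = cong (at u) (m<n⇒m%n≡m i<n)

omega-just : ∀ (u : Str σ) → NonEmpty u → ∀ i → ∃[ x ] omega u i ≡ just x
omega-just u@(_ ∷ _) _ i = at-< u (m%n<n i (length u))

omega-mod : ∀ (u : Str σ) → NonEmpty u → ∀ {N} .{{_ : NonZero N}} → length u ∣ N →
            ∀ i → omega u i ≡ omega u (i % N)
omega-mod u@(_ ∷ _) _ {N} n∣N i = cong (at u) (sym (m∣n⇒o%n%m≡o%m (length u) N i n∣N))

omega-pow : ∀ (z : Str σ) → NonEmpty z → ∀ j → omega (pow z (suc j)) ≗ omega z
omega-pow z@(_ ∷ _) _ j i = begin
  at zʲ (i % length zʲ)              ≡⟨ at-pow z (suc j) i%<length ⟩
  at z (i % length zʲ % length z)    ≡⟨ cong (at z) (m∣n⇒o%n%m≡o%m (length z) (length zʲ) i n∣length) ⟩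
  at z (i % length z)                ∎
  where
  open ≡-Reasoning
  zʲ = pow z (suc j)
  i%<length : i % length zʲ < suc j * length z
  i%<length = subst (i % length zʲ <_) (length-pow z (suc j)) (m%n<n i (length zʲ))
  n∣length : length z ∣ length zʲ
  n∣length = divides (suc j) (length-pow z (suc j))

periodic-prefix⇒pow : ∀ (u z : Str σ) .{{_ : NonZero (length z)}} q → length u ≡ q * length z →
  (∀ i → i < length z → at z i ≡ at u i) → HasPeriod (omega u) (length z) → u ≡ pow z q
periodic-prefix⇒pow u z q n≡qm z⊑u per = at-ext u (pow z q) at-u≡at-zᵠ
  where
  m = length z
  at-u≡at-zᵠ : at u ≗ at (pow z q)
  at-u≡at-zᵠ i with i <? length u
  ... | yes i<n = begin
    at u i                          ≡⟨ omega-< u i<n ⟨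
    omega u i                       ≡⟨ cong (omega u) (m≡m%n+[m/n]*n i m) ⟩
    omega u (i % m + (i / m) * m)   ≡⟨ HasPeriod-* per (i / m) (i % m) ⟩
    omega u (i % m)                 ≡⟨ omega-< u (<-≤-trans (m%n<n i m) m≤n) ⟩
    at u (i % m)                    ≡⟨ z⊑u (i % m) (m%n<n i m) ⟨
    at z (i % m)                    ≡⟨ at-pow z q (subst (i <_) n≡qm i<n) ⟨
    at (pow z q) i                  ∎
    where
    open ≡-Reasoning
    m≤n : m ≤ length u
    m≤n = ∣⇒≤ {{>-nonZero (≤-<-trans z≤n i<n)}} (divides q n≡qm)
  ... | no i≮n = trans (at-≥ u (≮⇒≥ i≮n))
    (sym (at-≥ (pow z q) (subst (_≤ i) (trans n≡qm (sym (length-pow z q))) (≮⇒≥ i≮n))))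

primitive-period : ∀ (r : Str σ) → Primitive r → ∀ {d} → 0 < d → d ∣ length r →
                   HasPeriod (omega r) d → d ≡ length r
primitive-period r (ne , ¬power) {d} 0<d (divides q n≡qd) per =
  exponent-one q n≡q|z|
    (periodic-prefix⇒pow r z {{nonZero}} q n≡q|z|
      (λ i i<|z| → at-take r (subst (i <_) |z|≡d i<|z|)) (subst (HasPeriod (omega r)) (sym |z|≡d) per))
  where
  z = take d r
  |z|≡d : length z ≡ d
  |z|≡d = trans (length-take d r) (m≤n⇒m⊓n≡m (∣⇒≤ {{>-nonZero ne}} (divides q n≡qd)))
  n≡q|z| : length r ≡ q * length z
  n≡q|z| = trans n≡qd (cong (q *_) (sym |z|≡d))
  nonZero : NonZero (length z)
  nonZero = >-nonZero (subst (0 <_) (sym |z|≡d) 0<d)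
  exponent-one : ∀ q → length r ≡ q * length z → r ≡ pow z q → d ≡ length r
  exponent-one 0             n≡0  _ = contradiction n≡0 (>⇒≢ ne)
  exponent-one 1             n≡m  _ = trans (sym |z|≡d) (sym (trans n≡m (+-identityʳ _)))
  exponent-one (suc (suc q)) _ r≡zᵠ = contradiction (z , 2 + q , s≤s (s≤s z≤n) , r≡zᵠ) ¬power

primitive-omega-injective : ∀ (r r′ : Str σ) → Primitive r → Primitive r′ →
                            omega r ≗ omega r′ → r ≡ r′
primitive-omega-injective r r′ pr@(ne , _) pr′@(ne′ , _) r≗r′ = at-ext r r′ at-r≡at-r′
  where
  n = length r
  d = gcd n (length r′)
  per-d : HasPeriod (omega r) d
  per-d = HasPeriod-gcd (omega-period r ne)
    (HasPeriod-resp-≗ (sym ∘ r≗r′) (omega-period r′ ne′))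
  0<d : 0 < d
  0<d = n≢0⇒n>0 (gcd[m,n]≢0 n (length r′) (inj₁ (>⇒≢ ne)))
  n≡n′ : n ≡ length r′
  n≡n′ = trans (sym (primitive-period r pr 0<d (gcd[m,n]∣m n (length r′)) per-d))
    (primitive-period r′ pr′ 0<d (gcd[m,n]∣n n (length r′)) (HasPeriod-resp-≗ r≗r′ per-d))
  at-r≡at-r′ : at r ≗ at r′
  at-r≡at-r′ i with i <? n
  ... | yes i<n = trans (sym (omega-< r i<n)) (trans (r≗r′ i) (omega-< r′ (subst (i <_) n≡n′ i<n)))
  ... | no  i≮n = trans (at-≥ r (≮⇒≥ i≮n)) (sym (at-≥ r′ (subst (_≤ i) n≡n′ (≮⇒≥ i≮n))))

omega-root : ∀ {u r : Str σ} {e} → NonEmpty u → HasRoot u r e → omega u ≗ omega r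
omega-root {e = zero}  ne (_ , refl)  = contradiction refl (>⇒≢ ne)
omega-root {r = r} {e = suc e} ne ((ne-r , _) , refl) = omega-pow r ne-r e

omega-≗⇒root-≡ : ∀ {u v r r′ : Str σ} {e f} → NonEmpty u → NonEmpty v → HasRoot u r e → HasRoot v r′ f →
                 omega u ≗ omega v → r ≡ r′
omega-≗⇒root-≡ {r = r} {r′} {e} {f} ne-u ne-v hu hv u≗v = primitive-omega-injective r r′ (proj₁ hu) (proj₁ hv)
  λ i → trans (sym (omega-root {e = e} ne-u hu i)) (trans (u≗v i) (omega-root {e = f} ne-v hv i))

root-unique : ∀ {u r r′ : Str σ} {e e′} → NonEmpty u → HasRoot u r e → HasRoot u r′ e′ →
              r ≡ r′ × e ≡ e′
root-unique {u = u} {r} {r′} {e} {e′} ne hr@(pr , u≡rᵉ) hr′@(pr′ , u≡r′ᵉ′) = r≡r′ , e≡e′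
  where
  r≡r′ : r ≡ r′
  r≡r′ = omega-≗⇒root-≡ {e = e} {e′} ne ne hr hr′ (λ _ → refl)
  e≡e′ : e ≡ e′
  e≡e′ = *-cancelʳ-≡ e e′ (length r) {{>-nonZero (proj₁ pr)}} (begin
    e * length r   ≡⟨ length-pow r e ⟨
    length (pow r e)  ≡⟨ cong length (trans (sym u≡rᵉ) u≡r′ᵉ′) ⟩
    length (pow r′ e′) ≡⟨ length-pow r′ e′ ⟩
    e′ * length r′ ≡⟨ cong (λ y → e′ * length y) r≡r′ ⟨
    e′ * length r  ∎)
    where open ≡-Reasoning

ProperPower : Str σ → Set
ProperPower u = ∃[ z ] ∃[ j ] (2 ≤ j × u ≡ pow z j)

-- A proper power u = zʲ has 0 < |z| < |u| and j ≤ |u|, so it suffices to search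
-- the prefixes of u and the exponents up to |u|.
properPower? : (u : Str σ) → Dec (ProperPower u)
properPower? []          = yes ([] , 2 , s≤s (s≤s z≤n) , refl)
properPower? u@(_ ∷ _) = map′ fromSearch toSearch
  (anyUpTo? (λ d → anyUpTo? (λ j → 2 ≤? j ×-dec u ≟ₛ pow (take d u) j) (suc n)) n)
  where
  n = length u
  fromSearch : ∃[ d ] (d < n × ∃[ j ] (j < suc n × (2 ≤ j × u ≡ pow (take d u) j))) → ProperPower u
  fromSearch (d , _ , j , _ , 2≤j , u≡zʲ) = take d u , j , 2≤j , u≡zʲ
  toSearch : ProperPower u → ∃[ d ] (d < n × ∃[ j ] (j < suc n × (2 ≤ j × u ≡ pow (take d u) j)))
  toSearch (z , j@(suc j′) , 2≤j , u≡zʲ) =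
    length z , subst (length z <_) (cong length (sym u≡zʲ)) (length-<-pow z ne-z 2≤j) ,
    j , s≤s (subst (j ≤_) (cong length (sym u≡zʲ)) (exponent-≤-length-pow z j ne-z)) ,
    2≤j , trans u≡zʲ (cong (λ y → pow y j) (sym take-|z|-u≡z))
    where
    ne-z : NonEmpty z
    ne-z = nonEmpty-pow⁻ z j (subst NonEmpty u≡zʲ (s≤s z≤n))
    take-|z|-u≡z : take (length z) u ≡ z
    take-|z|-u≡z = trans (cong (take (length z)) u≡zʲ) (take-length-++ z (pow z j′))

root-exists : ∀ (u : Str σ) → NonEmpty u → ∃₂ λ r e → HasRoot u r e
root-exists u = go u (<-wellFounded (length u))
  where
  go : ∀ (u : Str σ) → Acc _<_ (length u) → NonEmpty u → ∃₂ λ r e → HasRoot u r e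
  go u (acc smaller) ne with properPower? u
  ... | no ¬power = u , 1 , (ne , ¬power) , sym (++-identityʳ u)
  ... | yes (z , j , 2≤j , u≡zʲ) with go z (smaller |z|<|u|) ne-z
    where
    ne-z : NonEmpty z
    ne-z = nonEmpty-pow⁻ z j (subst NonEmpty u≡zʲ ne)
    |z|<|u| : length z < length u
    |z|<|u| = subst (length z <_) (cong length (sym u≡zʲ)) (length-<-pow z ne-z 2≤j)
  ... | r , e , pr , z≡rᵉ = r , j * e , pr , trans u≡zʲ (trans (cong (λ y → pow y j) z≡rᵉ) (pow-pow r e j))

-- The ω-order

LexLt-irrefl : ∀ {a b : Seq σ} → a ≗ b → ¬ LexLt a b
LexLt-irrefl a≗b (n , _ , x , y , aₙ≡x , bₙ≡y , x<y) =
  Fin.<-irrefl (Maybe.just-injective (trans (sym aₙ≡x) (trans (a≗b n) bₙ≡y))) x<y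

LexLt-resp-≗ : ∀ {a a′ b b′ : Seq σ} → a ≗ a′ → b ≗ b′ → LexLt a b → LexLt a′ b′
LexLt-resp-≗ a≗a′ b≗b′ (n , prefix , x , y , aₙ≡x , bₙ≡y , x<y) =
  n , (λ i i<n → trans (sym (a≗a′ i)) (trans (prefix i i<n) (b≗b′ i))) ,
  x , y , trans (sym (a≗a′ n)) aₙ≡x , trans (sym (b≗b′ n)) bₙ≡y , x<y

LexLt-trans : ∀ {a b c : Seq σ} → LexLt a b → LexLt b c → LexLt a c
LexLt-trans (m , a≡b , x , y , aₘ≡x , bₘ≡y , x<y) (n , b≡c , y′ , z , bₙ≡y′ , cₙ≡z , y′<z)
  with <-cmp m n
... | tri< m<n _ _ = m , (λ i i<m → trans (a≡b i i<m) (b≡c i (<-trans i<m m<n))) ,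
                     x , y , aₘ≡x , trans (sym (b≡c m m<n)) bₘ≡y , x<y
... | tri≈ _ refl _ = m , (λ i i<m → trans (a≡b i i<m) (b≡c i i<m)) ,
                      x , z , aₘ≡x , cₙ≡z , Fin.<-trans (subst (x <ᶠ_) y≡y′ x<y) y′<z
  where y≡y′ = Maybe.just-injective (trans (sym bₘ≡y) bₙ≡y′)
... | tri> _ _ n<m = n , (λ i i<n → trans (a≡b i (<-trans i<n n<m)) (b≡c i i<n)) ,
                     y′ , z , trans (a≡b n n<m) bₙ≡y′ , cₙ≡z , y′<z

first-mismatch : ∀ (a b : Seq σ) N → (∀ i → i < N → a i ≡ b i) ⊎
                 ∃[ i ] ((∀ j → j < i → a j ≡ b j) × a i ≢ b i)
first-mismatch a b zero = inj₁ (λ _ ())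
first-mismatch a b (suc N) with first-mismatch a b N
... | inj₂ mismatch = inj₂ mismatch
... | inj₁ a≡b with Maybe.≡-dec Fin._≟_ (a N) (b N)
...   | no  aₙ≢bₙ = inj₂ (N , a≡b , aₙ≢bₙ)
...   | yes aₙ≡bₙ = inj₁ λ i i<1+N →
  [ a≡b i , (λ { refl → aₙ≡bₙ }) ]′ (m≤n⇒m<n∨m≡n (≤-pred i<1+N))

-- Both sequences have period |u| |v|, so they agree everywhere once they agree below it.
omega-trichotomy : ∀ (u v : Str σ) → NonEmpty u → NonEmpty v →
  omega u ≗ omega v ⊎ LexLt (omega u) (omega v) ⊎ LexLt (omega v) (omega u)
omega-trichotomy u v ne-u ne-v with first-mismatch (omega u) (omega v) N
  where N = length u * length v
... | inj₁ agree = inj₁ λ i → begin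
  omega u i       ≡⟨ omega-mod u ne-u (divides (length v) (*-comm (length u) (length v))) i ⟩
  omega u (i % N) ≡⟨ agree (i % N) (m%n<n i N) ⟩
  omega v (i % N) ≡⟨ omega-mod v ne-v (divides (length u) refl) i ⟨
  omega v i       ∎
  where
  open ≡-Reasoning
  N = length u * length v
  instance _ = m*n≢0 (length u) (length v) {{>-nonZero ne-u}} {{>-nonZero ne-v}}
... | inj₂ (i , agree , differ) with omega-just u ne-u i | omega-just v ne-v i
...   | x , uᵢ≡x | y , vᵢ≡y with Fin.<-cmp x y
...     | tri< x<y _ _ = inj₂ (inj₁ (i , agree , x , y , uᵢ≡x , vᵢ≡y , x<y))
...     | tri≈ _ refl _ = contradiction (trans uᵢ≡x (sym vᵢ≡y)) differ
...     | tri> _ _ y<x = inj₂ (inj₂ (i , (λ j j<i → sym (agree j j<i)) , y , x , vᵢ≡y , uᵢ≡x , y<x))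

⪯ω-refl : ∀ {u : Str σ} → NonEmpty u → u ⪯ω u
⪯ω-refl {u = u} ne with root-exists u ne
... | r , e , hr = inj₁ (r , e , e , hr , hr , ≤-refl)

⪯ω-nonEmpty : ∀ {u v : Str σ} → NonEmpty u → u ⪯ω v → NonEmpty v
⪯ω-nonEmpty {v = _ ∷ _} _ _ = s≤s z≤n
⪯ω-nonEmpty {v = []} ne (inj₁ (r , e , zero , (_ , u≡rᵉ) , _ , z≤n)) =
  contradiction (cong length u≡rᵉ) (>⇒≢ ne)
⪯ω-nonEmpty {v = []} ne (inj₁ ([]    , e , suc f , _ , ((() , _) , _) , _))
⪯ω-nonEmpty {v = []} ne (inj₁ (_ ∷ _ , e , suc f , _ , (_ , ()) , _))
⪯ω-nonEmpty {v = []} ne (inj₂ (_ , _ , _ , _ , _ , _ , _ , _ , _ , _ , _ , _ , () , _))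

⪯ω-total : ∀ {u v : Str σ} → NonEmpty u → NonEmpty v → u ⪯ω v ⊎ v ⪯ω u
⪯ω-total {u = u} {v} ne-u ne-v with root-exists u ne-u | root-exists v ne-v
... | r , e , hu | r′ , f , hv with r ≟ₛ r′
...   | yes refl = [ (λ e≤f → inj₁ (inj₁ (r , e , f , hu , hv , e≤f)))
                   , (λ f≤e → inj₂ (inj₁ (r , f , e , hv , hu , f≤e))) ]′ (≤-total e f)
...   | no  r≢r′ with omega-trichotomy u v ne-u ne-v
...     | inj₁ u≗v = contradiction (omega-≗⇒root-≡ {e = e} {f} ne-u ne-v hu hv u≗v) r≢r′
...     | inj₂ (inj₁ u<v) = inj₁ (inj₂ (r , r′ , e , f , hu , hv , r≢r′ , u<v))
...     | inj₂ (inj₂ v<u) = inj₂ (inj₂ (r′ , r , f , e , hv , hu , r≢r′ ∘ sym , v<u))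

⪯ω-trans : ∀ {u v w : Str σ} → NonEmpty u → u ⪯ω v → v ⪯ω w → u ⪯ω w
⪯ω-trans {u = u} {v} {w} ne-u u⪯v v⪯w = go u⪯v v⪯w
  where
  ne-v = ⪯ω-nonEmpty ne-u u⪯v
  ne-w = ⪯ω-nonEmpty ne-v v⪯w
  go : u ⪯ω v → v ⪯ω w → u ⪯ω w
  go (inj₁ (r , e , f , hu , hv , e≤f)) (inj₁ (_ , f′ , g , hv′ , hw , f′≤g))
    with refl , refl ← root-unique {e = f} {e′ = f′} ne-v hv hv′
    = inj₁ (r , e , g , hu , hw , ≤-trans e≤f f′≤g)
  go (inj₁ (r , e , f , hu , hv , _)) (inj₂ (_ , r″ , f′ , g , hv′ , hw , r≢r″ , v<w))
    with refl , refl ← root-unique {e = f} {e′ = f′} ne-v hv hv′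
    = inj₂ (r , r″ , e , g , hu , hw , r≢r″ ,
            LexLt-resp-≗ (λ i → trans (omega-root {e = f} ne-v hv i) (sym (omega-root {e = e} ne-u hu i)))
                         (λ _ → refl) v<w)
  go (inj₂ (r , r′ , e , f , hu , hv , r≢r′ , u<v)) (inj₁ (_ , f′ , g , hv′ , hw , _))
    with refl , refl ← root-unique {e = f} {e′ = f′} ne-v hv hv′
    = inj₂ (r , r′ , e , g , hu , hw , r≢r′ ,
            LexLt-resp-≗ (λ _ → refl)
                         (λ i → trans (omega-root {e = f} ne-v hv i) (sym (omega-root {e = g} ne-w hw i))) u<v)
  go (inj₂ (r , _ , e , _ , hu , _ , _ , u<v)) (inj₂ (_ , r″ , _ , g , _ , hw , _ , v<w)) =
    inj₂ (r , r″ , e , g , hu , hw , r≢r″ , LexLt-trans u<v v<w)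
    where
    r≢r″ : r ≢ r″
    r≢r″ refl = LexLt-irrefl (λ i → trans (omega-root {e = e} ne-u hu i) (sym (omega-root {e = g} ne-w hw i)))
                  (LexLt-trans u<v v<w)

⪯ω-antisym : ∀ {u v : Str σ} → NonEmpty u → u ⪯ω v → v ⪯ω u → u ≡ v
⪯ω-antisym ne-u u⪯v@(inj₁ (r , e , f , hu , hv , e≤f)) (inj₁ (_ , f′ , e′ , hv′ , hu′ , f′≤e′))
  with refl , refl ← root-unique {e = f} {e′ = f′} (⪯ω-nonEmpty ne-u u⪯v) hv hv′
     | refl , refl ← root-unique {e = e} {e′ = e′} ne-u hu hu′
  = trans (proj₂ hu) (trans (cong (pow r) (≤-antisym e≤f f′≤e′)) (sym (proj₂ hv)))
⪯ω-antisym ne-u u⪯v@(inj₁ (_ , e , f , hu , hv , _)) (inj₂ (_ , _ , f′ , e′ , hv′ , hu′ , r′≢r″ , _))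
  with refl , refl ← root-unique {e = f} {e′ = f′} (⪯ω-nonEmpty ne-u u⪯v) hv hv′
     | refl , refl ← root-unique {e = e} {e′ = e′} ne-u hu hu′
  = contradiction refl r′≢r″
⪯ω-antisym ne-u u⪯v@(inj₂ (_ , _ , e , f , hu , hv , r≢r′ , _)) (inj₁ (_ , f′ , e′ , hv′ , hu′ , _))
  with refl , refl ← root-unique {e = f} {e′ = f′} (⪯ω-nonEmpty ne-u u⪯v) hv hv′
     | refl , refl ← root-unique {e = e} {e′ = e′} ne-u hu hu′
  = contradiction refl r≢r′
⪯ω-antisym ne-u (inj₂ (_ , _ , _ , _ , _ , _ , _ , u<v)) (inj₂ (_ , _ , _ , _ , _ , _ , _ , v<u)) =
  contradiction (LexLt-trans u<v v<u) (LexLt-irrefl (λ _ → refl))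

-- Runs and counting

runs-∷-≤ : ∀ (x : Fin σ) xs → runs (x ∷ xs) ≤ 1 + runs xs
runs-∷-≤ x []       = z≤n
runs-∷-≤ x (y ∷ xs) with x Fin.≟ y
... | yes _ = n≤1+n _
... | no  _ = ≤-refl

runs-≤-∷ : ∀ (x : Fin σ) xs → runs xs ≤ runs (x ∷ xs)
runs-≤-∷ x []       = z≤n
runs-≤-∷ x (y ∷ xs) = m≤n+m (runs (y ∷ xs)) _

runs-∷-∷ : ∀ (x : Fin σ) xs → runs (x ∷ x ∷ xs) ≡ runs (x ∷ xs)
runs-∷-∷ x xs with x Fin.≟ x
... | yes _   = refl
... | no  x≢x = contradiction refl x≢x

runs-insertAt : ∀ (xs : Str σ) y zs → runs (xs ++ y ∷ zs) ≤ 2 + runs (xs ++ zs)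
runs-insertAt []           y zs = ≤-trans (runs-∷-≤ y zs) (n≤1+n _)
runs-insertAt (x ∷ [])     y zs = begin
  runs (x ∷ y ∷ zs)  ≤⟨ runs-∷-≤ x (y ∷ zs) ⟩
  1 + runs (y ∷ zs)  ≤⟨ s≤s (runs-∷-≤ y zs) ⟩
  2 + runs zs        ≤⟨ +-monoʳ-≤ 2 (runs-≤-∷ x zs) ⟩
  2 + runs (x ∷ zs)  ∎
  where open ≤-Reasoning
runs-insertAt (x ∷ x′ ∷ xs) y zs =
  ≤-trans (+-monoʳ-≤ _ (runs-insertAt (x′ ∷ xs) y zs)) (≤-reflexive (x∙yz≈y∙xz _ 2 _))

module _ {a} {A : Set a} (_≟_ : DecidableEquality A) where

  runs-map≤length-derun : ∀ (f : A → Fin σ) xs → runs (map f xs) ≤ length (derun _≟_ xs)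
  runs-map≤length-derun f []                = z≤n
  runs-map≤length-derun f (x ∷ [])          = z≤n
  runs-map≤length-derun f (x ∷ ys@(y ∷ xs)) = step (runs-map≤length-derun f ys)
    where
    step : runs (map f ys) ≤ length (derun _≟_ ys) → runs (map f (x ∷ ys)) ≤ length (derun _≟_ (x ∷ ys))
    step ih with x ≟ y
    ... | yes refl = subst (_≤ length (derun _≟_ ys)) (sym (runs-∷-∷ (f x) (map f xs))) ih
    ... | no  _    = ≤-trans (runs-∷-≤ (f x) (map f ys)) (s≤s ih)

  AllPairs⇒Grouped : ∀ {ℓ} {_≤_ : Rel A ℓ} → Antisymmetric _≡_ _≤_ →
                     ∀ {xs} → AllPairs _≤_ xs → Grouped _≡_ xs
  AllPairs⇒Grouped antisym []        = []
  AllPairs⇒Grouped antisym ([] ∷ []) = [] ∷≉ []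
  AllPairs⇒Grouped {_≤_ = _≤_} antisym {x ∷ y ∷ zs} ((x≤y ∷ _) ∷ sorted@(y≤zs ∷ _)) =
    step (AllPairs⇒Grouped antisym sorted)
    where
    step : Grouped _≡_ (y ∷ zs) → Grouped _≡_ (x ∷ y ∷ zs)
    step grouped with x ≟ y
    ... | yes x≡y = x≡y ∷≈ grouped
    ... | no  x≢y = (x≢y ∷ All.map (λ y≤z x≡z → x≢y (antisym x≤y (subst (y ≤_) (sym x≡z) y≤z))) y≤zs)
                    ∷≉ grouped

Unique-⊆⇒length≤ : ∀ {a} {A : Set a} {xs ys : List A} → Unique xs → xs ⊆ ys → length xs ≤ length ys
Unique-⊆⇒length≤ {xs = []}     _                _      = z≤n
Unique-⊆⇒length≤ {xs = x ∷ xs} (x∉xs ∷ unique) x∷xs⊆ys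
  with ys₁ , ys₂ , refl ← ∈-∃++ (x∷xs⊆ys (here refl)) =
  subst (suc (length xs) ≤_) (sym (length-++-sucʳ ys₁ x ys₂)) (s≤s (Unique-⊆⇒length≤ unique xs⊆ys₁ys₂))
  where
  xs⊆ys₁ys₂ : xs ⊆ ys₁ ++ ys₂
  xs⊆ys₁ys₂ {z} z∈xs with ∈-++⁻ ys₁ (x∷xs⊆ys (there z∈xs))
  ... | inj₁ z∈ys₁         = ∈-++⁺ˡ z∈ys₁
  ... | inj₂ (here refl)   = contradiction refl (All.lookup x∉xs z∈xs)
  ... | inj₂ (there z∈ys₂) = ∈-++⁺ʳ ys₁ z∈ys₂

length-cartesianProductWith : ∀ {a b c} {A : Set a} {B : Set b} {C : Set c} (f : A → B → C) xs ys →
                              length (cartesianProductWith f xs ys) ≡ length xs * length ys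
length-cartesianProductWith f []       ys = refl
length-cartesianProductWith f (x ∷ xs) ys = begin
  length (map (f x) ys ++ cartesianProductWith f xs ys)  ≡⟨ length-++ (map (f x) ys) ⟩
  length (map (f x) ys) + length (cartesianProductWith f xs ys)
    ≡⟨ cong₂ _+_ (length-map (f x) ys) (length-cartesianProductWith f xs ys) ⟩
  length ys + length xs * length ys  ∎
  where open ≡-Reasoning

strings : ∀ σ → ℕ → List (Str σ)
strings σ zero    = [ [] ]
strings σ (suc n) = cartesianProductWith _∷_ (allFin σ) (strings σ n)

length-strings : ∀ σ n → length (strings σ n) ≡ σ ^ n
length-strings σ zero    = refl
length-strings σ (suc n) = trans (length-cartesianProductWith _∷_ (allFin σ) (strings σ n))
  (cong₂ _*_ (length-tabulate {n = σ} (λ i → i)) (length-strings σ n))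

∈-strings : ∀ (u : Str σ) → u ∈ strings σ (length u)
∈-strings []      = here refl
∈-strings (x ∷ u) = ∈-cartesianProductWith⁺ _∷_ (∈-allFin x) (∈-strings u)

-- Sorting rotations

length-rot : ∀ (w : Str σ) {i} → i ≤ length w → length (rot i w) ≡ length w
length-rot w {i} i≤n = begin
  length (drop i w ++ take i w)           ≡⟨ length-++ (drop i w) ⟩
  length (drop i w) + length (take i w)   ≡⟨ cong₂ _+_ (length-drop i w) (trans (length-take i w) (m≤n⇒m⊓n≡m i≤n)) ⟩
  (length w ∸ i) + i                      ≡⟨ m∸n+n≡m i≤n ⟩
  length w                                ∎
  where open ≡-Reasoning

length-rotationsOf : ∀ (w : Str σ) → length (rotationsOf w) ≡ length w
length-rotationsOf w = trans (length-map (λ i → rot i w) (upTo (length w))) (length-upTo (length w))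

All-rotations : ∀ {p} {P : ℕ → Set p} {W : List (Str σ)} → All (P ∘ length) W → All (P ∘ length) (rotations W)
All-rotations []                 = []
All-rotations {P = P} {w ∷ _} (p ∷ ps) = All.++⁺
  (All.map⁺ (All.applyUpTo⁺₁ id (length w) (λ i<n → subst P (sym (length-rot w (<⇒≤ i<n))) p)))
  (All-rotations {P = P} ps)

rotations-++ : ∀ (xs ys : List (Str σ)) → rotations (xs ++ ys) ≡ rotations xs ++ rotations ys
rotations-++ xs ys =
  trans (cong concat (map-++ rotationsOf xs ys)) (sym (concat-++ (map rotationsOf xs) (map rotationsOf ys)))

lastOr : Fin σ → Str σ → Fin σ
lastOr x []       = x
lastOr _ (y ∷ ys) = lastOr y ys

last-∷ : ∀ (x : Fin σ) xs → last (x ∷ xs) ≡ just (lastOr x xs)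
last-∷ x []       = refl
last-∷ x (y ∷ ys) = last-∷ y ys

-- The empty string is put below everything; no rotation is empty, so on rotations this is ⪯ω.
_≼_ : Str σ → Str σ → Set
u ≼ v = NonEmpty u → u ⪯ω v

≼-trans : ∀ {u v w : Str σ} → u ≼ v → v ≼ w → u ≼ w
≼-trans u≼v v≼w ne-u = ⪯ω-trans ne-u (u≼v ne-u) (v≼w (⪯ω-nonEmpty ne-u (u≼v ne-u)))

≼-antisym : ∀ {u v : Str σ} → u ≼ v → v ≼ u → u ≡ v
≼-antisym {u = []}    {[]}    _   _   = refl
≼-antisym {u = []}    {_ ∷ _} _   v≼u with () ← ⪯ω-nonEmpty (s≤s z≤n) (v≼u (s≤s z≤n))
≼-antisym {u = _ ∷ _}         u≼v v≼u = ⪯ω-antisym ne u⪯v (v≼u (⪯ω-nonEmpty ne u⪯v))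
  where
  ne = s≤s z≤n
  u⪯v = u≼v ne

≼-total : (u v : Str σ) → u ≼ v ⊎ v ≼ u
≼-total []        _         = inj₁ λ ()
≼-total (_ ∷ _)   []        = inj₂ λ ()
≼-total (_ ∷ _)   (_ ∷ _)   = Sum.map const const (⪯ω-total (s≤s z≤n) (s≤s z≤n))

_≼?_ : (u v : Str σ) → Dec (u ≼ v)
[]      ≼? _ = yes λ ()
(_ ∷ _) ≼? [] = no λ u≼[] → contradiction (⪯ω-nonEmpty (s≤s z≤n) (u≼[] (s≤s z≤n))) λ ()
u@(_ ∷ _) ≼? v@(_ ∷ _) with ⪯ω-total {u = u} {v} (s≤s z≤n) (s≤s z≤n)
... | inj₁ u⪯v = yes (const u⪯v)
... | inj₂ v⪯u with u ≟ₛ v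
...   | yes refl = yes (const v⪯u)
...   | no  u≢v  = no λ u≼v → u≢v (⪯ω-antisym (s≤s z≤n) (u≼v (s≤s z≤n)) v⪯u)

≼-decTotalOrder : ℕ → DecTotalOrder 0ℓ 0ℓ 0ℓ
≼-decTotalOrder σ = record
  { Carrier         = Str σ
  ; _≈_             = _≡_
  ; _≤_             = _≼_
  ; isDecTotalOrder = record
    { isTotalOrder = record
      { isPartialOrder = record
        { isPreorder = record
          { isEquivalence = isEquivalence
          ; reflexive     = λ { refl → ⪯ω-refl }
          ; trans         = ≼-trans
          }
        ; antisym = ≼-antisym
        }
      ; total = ≼-total
      }
    ; _≟_  = _≟ₛ_
    ; _≤?_ = _≼?_
    }
  }

Linked-≼⇒⪯ω : ∀ {xs : List (Str σ)} → All NonEmpty xs → Linked _≼_ xs → Linked _⪯ω_ xs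
Linked-≼⇒⪯ω _          []          = []
Linked-≼⇒⪯ω _          [-]         = [-]
Linked-≼⇒⪯ω (ne ∷ nes) (u≼v ∷ v≼) = u≼v ne ∷ Linked-≼⇒⪯ω nes v≼

module _ {σ : ℕ} where
  open DecTotalOrder (≼-decTotalOrder σ) using (totalOrder)
  open import Data.List.Sort.InsertionSort.Base (≼-decTotalOrder σ) public
  open import Data.List.Sort.InsertionSort.Properties (≼-decTotalOrder σ)

  sort-↭-≡ : ∀ {xs ys : List (Str σ)} → xs ↭ ys → sort xs ≡ sort ys
  sort-↭-≡ {xs} {ys} xs↭ys = Pointwise-≡⇒≡ (↗↭↗⇒≋ totalOrder (sort-↗ xs) (sort-↗ ys)
    (↭⇒↭ₛ (↭-trans (sort-↭ xs) (↭-trans xs↭ys (↭-sym (sort-↭ ys))))))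

  insert-split : ∀ x (xs : List (Str σ)) → ∃₂ λ ys zs → xs ≡ ys ++ zs × insert x xs ≡ ys ++ x ∷ zs
  insert-split x []       = [] , [] , refl , refl
  insert-split x (y ∷ xs) with x ≼? y
  ... | yes _ = [] , y ∷ xs , refl , refl
  ... | no  _ with ys , zs , refl , eq ← insert-split x xs = y ∷ ys , zs , refl , cong (y ∷_) eq

  runs-map-insert : ∀ {τ} (f : Str σ → Fin τ) x xs → runs (map f (insert x xs)) ≤ 2 + runs (map f xs)
  runs-map-insert f x xs with ys , zs , refl , eq ← insert-split x xs = begin
    runs (map f (insert x (ys ++ zs)))   ≡⟨ cong (runs ∘ map f) eq ⟩
    runs (map f (ys ++ x ∷ zs))          ≡⟨ cong runs (map-++ f ys (x ∷ zs)) ⟩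
    runs (map f ys ++ f x ∷ map f zs)    ≤⟨ runs-insertAt (map f ys) (f x) (map f zs) ⟩
    2 + runs (map f ys ++ map f zs)      ≡⟨ cong (λ u → 2 + runs u) (map-++ f ys zs) ⟨
    2 + runs (map f (ys ++ zs))          ∎
    where open ≤-Reasoning

  runs-map-sort-++ : ∀ {τ} (f : Str σ → Fin τ) xs ys →
                     runs (map f (sort (xs ++ ys))) ≤ 2 * length ys + runs (map f (sort xs))
  runs-map-sort-++ f xs ys =
    subst (λ zs → runs (map f zs) ≤ 2 * length ys + R) (sort-↭-≡ (++-comm ys xs)) (insert-all ys)
    where
    R = runs (map f (sort xs))
    insert-all : ∀ ys → runs (map f (sort (ys ++ xs))) ≤ 2 * length ys + R
    insert-all []       = ≤-refl
    insert-all (y ∷ ys) = begin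
      runs (map f (insert y (sort (ys ++ xs)))) ≤⟨ runs-map-insert f y (sort (ys ++ xs)) ⟩
      2 + runs (map f (sort (ys ++ xs)))        ≤⟨ +-monoʳ-≤ 2 (insert-all ys) ⟩
      2 + (2 * length ys + R)                   ≡⟨ +-assoc 2 (2 * length ys) R ⟨
      (2 + 2 * length ys) + R                   ≡⟨ cong (_+ R) (*-suc 2 (length ys)) ⟨
      2 * suc (length ys) + R                   ∎
      where open ≤-Reasoning

  runs-map-sort-≤ : ∀ {τ} (f : Str σ → Fin τ) {n} xs → All (λ u → length u ≡ n) xs →
                    runs (map f (sort xs)) ≤ σ ^ n
  runs-map-sort-≤ f {n} xs lengths = begin
    runs (map f (sort xs))              ≤⟨ runs-map≤length-derun _≟ₛ_ f (sort xs) ⟩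
    length (derun _≟ₛ_ (sort xs))       ≤⟨ Unique-⊆⇒length≤ unique derun⊆strings ⟩
    length (strings σ n)                ≡⟨ length-strings σ n ⟩
    σ ^ n                               ∎
    where
    open ≤-Reasoning
    unique : Unique (derun _≟ₛ_ (sort xs))
    unique = grouped[xs]⇒unique[derun[xs]] _≟ₛ_ (sort xs)
      (AllPairs⇒Grouped _≟ₛ_ ≼-antisym (Linked⇒AllPairs ≼-trans (sort-↗ xs)))
    derun⊆strings : derun _≟ₛ_ (sort xs) ⊆ strings σ n
    derun⊆strings {u} u∈derun = subst (λ m → u ∈ strings σ m) (All.lookup lengths u∈xs) (∈-strings u)
      where u∈xs = ∈-resp-↭ (sort-↭ xs) (∈-derun⁻ _≟ₛ_ (sort xs) u∈derun)

  runs-ebwt-blocks : ∀ {τ} (f : Str σ → Fin τ) {n} blocks t → All (λ b → length b ≡ n) blocks →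
                     runs (map f (sort (rotations (blocks ++ [ t ])))) ≤ 2 * length t + σ ^ n
  runs-ebwt-blocks f {n} blocks t lengths = begin
    runs (map f (sort (rotations (blocks ++ [ t ]))))
      ≡⟨ cong (runs ∘ map f ∘ sort) (trans (rotations-++ blocks [ t ]) (cong (rotations blocks ++_) (++-identityʳ T))) ⟩
    runs (map f (sort (rotations blocks ++ T)))
      ≤⟨ runs-map-sort-++ f (rotations blocks) T ⟩
    2 * length T + runs (map f (sort (rotations blocks)))
      ≤⟨ +-mono-≤ (≤-reflexive (cong (2 *_) (length-rotationsOf t)))
                  (runs-map-sort-≤ f (rotations blocks) (All-rotations {P = _≡ n} lengths)) ⟩
    2 * length t + σ ^ n ∎
    where
    open ≤-Reasoning
    T = rotationsOf t

  -- The default letter c is never used, since every rotation is nonempty.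
  sort-isEbwt : ∀ (c : Fin σ) (W : List (Str σ)) → All NonEmpty W →
                IsEbwt W (map (lastOr c) (sort (rotations W)))
  sort-isEbwt c W ne-W = sort (rotations W) , sort-↭ (rotations W) ,
    Linked-≼⇒⪯ω ne-sorted (sort-↗ (rotations W)) , lasts ne-sorted
    where
    ne-sorted : All NonEmpty (sort (rotations W))
    ne-sorted = All-resp-↭ (↭-sym (sort-↭ (rotations W))) (All-rotations {P = 0 <_} ne-W)
    lasts : ∀ {xs} → All NonEmpty xs → Pointwise (λ r c → last r ≡ just c) xs (map (lastOr c) xs)
    lasts []                   = []
    lasts {(x ∷ xs) ∷ _} (_ ∷ nes) = last-∷ x xs ∷ lasts nes

-- Block decompositions

record BlockDecomposition (k : ℕ) (w : Str σ) : Set where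
  field
    blocks       : List (Str σ)
    tail         : Str σ
    concat-≡     : concat (blocks ++ [ tail ]) ≡ w
    block-length : All (λ b → length b ≡ suc k) blocks
    k<tail       : k < length tail
    tail≤2k+1    : length tail ≤ 2 * k + 1

blockDecomposition : ∀ k (w : Str σ) → k < length w → BlockDecomposition k w
blockDecomposition {σ} k w = go w (<-wellFounded (length w))
  where
  suc[2k+1]≡[1+k]+[1+k] : ∀ k → suc (2 * k + 1) ≡ suc k + suc k
  suc[2k+1]≡[1+k]+[1+k] = solve-∀
  go : ∀ (w : Str σ) → Acc _<_ (length w) → k < length w → BlockDecomposition k w
  go w (acc smaller) k<w with length w ≤? 2 * k + 1
  ... | yes w≤2k+1 = record
    { blocks = [] ; tail = w ; concat-≡ = ++-identityʳ w ; block-length = [] ; k<tail = k<w ; tail≤2k+1 = w≤2k+1 }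
  ... | no  w≰2k+1 = record
    { blocks       = take (suc k) w ∷ blocks
    ; tail         = tail
    ; concat-≡     = trans (cong (take (suc k) w ++_) concat-≡) (take++drop≡id (suc k) w)
    ; block-length = trans (length-take (suc k) w) (m≤n⇒m⊓n≡m k<w) ∷ block-length
    ; k<tail       = k<tail
    ; tail≤2k+1    = tail≤2k+1
    }
    where
    |w′|≡ : length (drop (suc k) w) ≡ length w ∸ suc k
    |w′|≡ = length-drop (suc k) w
    k<w′ : k < length (drop (suc k) w)
    k<w′ = subst (k <_) (sym |w′|≡)
      (m+n≤o⇒m≤o∸n (suc k) (subst (_≤ length w) (suc[2k+1]≡[1+k]+[1+k] k) (≰⇒> w≰2k+1)))
    w′<w : length (drop (suc k) w) < length w
    w′<w = subst (_< length w) (sym |w′|≡) (∸-monoʳ-< (s≤s z≤n) k<w)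
    open BlockDecomposition (go (drop (suc k) w) (smaller w′<w) k<w′)

theorem2 : (σ k : ℕ) → 1 ≤ k → (w : Str σ) → k + 1 ≤ length w →
    ∃[ D ] ∃[ b ] (IsKDecomp k w D × IsEbwt D b × runs b ≤ σ ^ (k + 1) + 4 * k + 2)
theorem2 σ k _ []         k+1≤0   with () ← m+n≤o⇒n≤o k k+1≤0
theorem2 σ k _ w@(c ∷ _) k+1≤|w| =
  D , map (lastOr c) (sort (rotations D)) , (concat-≡ , long-blocks) ,
  sort-isEbwt c D (All.map (<-≤-trans (s≤s z≤n)) long-blocks) , runs-bound
  where
  open BlockDecomposition (blockDecomposition k w (subst (_≤ length w) (+-comm k 1) k+1≤|w|))
  D = blocks ++ [ tail ]
  long-blocks : All (λ x → k < length x) D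
  long-blocks = All.++⁺ (All.map (≤-reflexive ∘ sym) block-length) (k<tail ∷ [])
  arithmetic : ∀ P k → 2 * (2 * k + 1) + P ≡ P + 4 * k + 2
  arithmetic = solve-∀
  runs-bound : runs (map (lastOr c) (sort (rotations D))) ≤ σ ^ (k + 1) + 4 * k + 2
  runs-bound = begin
    runs (map (lastOr c) (sort (rotations D))) ≤⟨ runs-ebwt-blocks (lastOr c) blocks tail block-length ⟩
    2 * length tail + σ ^ suc k                ≤⟨ +-monoˡ-≤ (σ ^ suc k) (*-monoʳ-≤ 2 tail≤2k+1) ⟩
    2 * (2 * k + 1) + σ ^ suc k                ≡⟨ arithmetic (σ ^ suc k) k ⟩
    σ ^ suc k + 4 * k + 2                      ≡⟨ cong (λ n → σ ^ n + 4 * k + 2) (+-comm 1 k) ⟩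
    σ ^ (k + 1) + 4 * k + 2                    ∎
    where open ≤-Reasoning
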